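{- Let $k\ge2$ and $a\in\mathbb{N}$ with $a\ge1$. For all $n\in\mathbb{N}$, \[ c^{(k)}((a.k);n)=\sum_{i=\max\{n-k+1,0\}}^{n-1}c^{(k)}((a.k);i)+[a>k]\,c^{(k)}((a-k\,.\,0);n-k)+[n=a+k-1], \] where $c^{(k)}(\cdot\,;m)=0$ for $m<0$ and an empty sum is $0$.
   Context: Words are over the alphabet $\mathbb{N}=\{0,1,2,\dots\}$; $(x.y)$ denotes the length-2 word with letters $x,y$. For $k\ge 2$, $\phi_k$ is the morphism of $\mathbb{N}^*$ defined for $i\in\mathbb{N}$, $0\le j\le k-1$ by $\phi_k(ki+j)=(ki)(ki+j+1)$ if $0\le j\le k-2$ and $\phi_k(ki+k-1)=ki+k$; $W_n^{(k)}=\phi_k^n(0)$. For a nonempty word $B$, $c^{(k)}(B;n)$ is the number of (possibly overlapping) occurrences of $B$ as a factor of $W_n^{(k)}$. $[P]$ is the Iverson bracket. -}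

module Defs where

open import Data.Nat using (ℕ; zero; suc; _+_; _*_; _∸_; _<ᵇ_; _≡ᵇ_)
open import Data.Nat.DivMod using (_/_; _%_)
open import Data.Bool using (Bool; true; false; if_then_else_; _∧_)
open import Data.List using (List; []; _∷_; concatMap; map; upTo; length; filter; tails)
open import Data.Bool using (T)
open import Relation.Nullary.Decidable using (T?)
open import Data.Nat using (_≤ᵇ_)

-- Writing m = k*i + j (0 ≤ j ≤ k-1):
--   φ_k(m) = (k i)(m+1)  if j ≤ k-2,   φ_k(m) = m+1 (= k i + k)  if j = k-1.
-- (For k = 0 the definition is irrelevant; we return [m].)
φ-letter : ℕ → ℕ → List ℕ
φ-letter zero m = m ∷ []
φ-letter (suc k') m =
  if suc (m % suc k') <ᵇ suc k'
  then (suc k' * (m / suc k')) ∷ suc m ∷ []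
  else suc m ∷ []

φ : ℕ → List ℕ → List ℕ
φ k w = concatMap (φ-letter k) w

φ^ : ℕ → ℕ → List ℕ → List ℕ
φ^ k zero w = w
φ^ k (suc n) w = φ k (φ^ k n w)

W : ℕ → ℕ → List ℕ
W k n = φ^ k n (0 ∷ [])

isPrefix : List ℕ → List ℕ → Bool
isPrefix [] _ = true
isPrefix (_ ∷ _) [] = false
isPrefix (x ∷ xs) (y ∷ ys) = (x ≡ᵇ y) ∧ isPrefix xs ys

occ : List ℕ → List ℕ → ℕ
occ B w = length (filter (λ s → T? (isPrefix B s)) (tails w))

c : ℕ → List ℕ → ℕ → ℕ
c k B n = occ B (W k n)

pair : ℕ → ℕ → List ℕ
pair x y = x ∷ y ∷ []

[_] : Bool → ℕ
[ true ] = 1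
[ false ] = 0

range : ℕ → ℕ → List ℕ
range lo hi = map (lo +_) (upTo (hi ∸ lo))

cShift : ℕ → List ℕ → ℕ → ℕ → ℕ
cShift k B n m = if m ≤ᵇ n then c k B (n ∸ m) else 0

{-# OPTIONS --safe #-}
module Submission where

-- Put Φ n j = φ_k^n(j), so that W_n = Φ n 0.  As φ_k(j) = 0 (j+1) for j < k-1, φ_k(k-1) = k, and
-- φ_k commutes with adding k to every letter,
--   Φ (n+1) j = Φ n 0 · Φ n (j+1)  for j < k-1,      Φ (n+1) (k-1) = k + Φ n 0.
-- Unfolding j = 0, 1, …, k-1 cuts W_n into the blocks W_{n-1}, …, W_{n-k+1}, k + W_{n-k}
-- (truncated when n < k).  The shifted block contains (a.k) exactly where W_{n-k} contains
-- (a-k.0) if a > k; for a = k it would need a factor (0.0), which never occurs.  Every block W_m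
-- ends with the letter m and is followed by a block starting with 0, except the last one, which
-- starts with k: so the single occurrence across a junction is W_a | k + W_{n-k}, when n = a+k-1.

open import Defs
open import Data.Nat using (ℕ; _+_; _*_; _∸_; _≤_; _<ᵇ_; _≡ᵇ_)
open import Data.List using (map)
open import Data.Nat.ListAction using (sum)
open import Relation.Binary.PropositionalEquality using (_≡_)

open import Data.Bool using (true; false; _∧_)
open import Data.Bool.Properties using (∧-identityʳ; ∧-zeroʳ)
open import Data.Empty using (⊥-elim)
open import Data.List using (List; []; _∷_; _++_; _∷ʳ_; upTo; head; last)
open import Data.List.Properties using (map-++; concatMap-++; ++-identityʳ; upTo-∷ʳ; head-map; last-map)
open import Data.Maybe using (Maybe; just; nothing)
import Data.Maybe as Maybe
open import Data.Nat using (zero; suc; _<_; z≤n; s≤s)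
open import Data.Nat.DivMod using (_/_; _%_; m<n⇒m%n≡m; m<n⇒m/n≡0; [m+n]%n≡m%n; m/n≡1+[m∸n]/n)
open import Data.Nat.ListAction.Properties using (sum-++)
open import Data.Nat.Properties
open import Data.Nat.Tactic.RingSolver using (solve-∀)
open import Data.Sum using (inj₁; inj₂)
open import Function using (_∘_)
open import Relation.Binary.Definitions using (tri<; tri≈; tri>)
open import Relation.Binary.PropositionalEquality using (refl; sym; trans; cong; cong₂; subst; module ≡-Reasoning)
open import Relation.Nullary using (¬_)

open ≡-Reasoning

≡ᵇ-refl : ∀ n → (n ≡ᵇ n) ≡ true
≡ᵇ-refl zero    = refl
≡ᵇ-refl (suc n) = ≡ᵇ-refl n

≡ᵇ-comm : ∀ m n → (m ≡ᵇ n) ≡ (n ≡ᵇ m)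
≡ᵇ-comm zero    zero    = refl
≡ᵇ-comm zero    (suc n) = refl
≡ᵇ-comm (suc m) zero    = refl
≡ᵇ-comm (suc m) (suc n) = ≡ᵇ-comm m n

+-cancelˡ-≡ᵇ : ∀ m x y → (m + x ≡ᵇ m + y) ≡ (x ≡ᵇ y)
+-cancelˡ-≡ᵇ zero    x y = refl
+-cancelˡ-≡ᵇ (suc m) x y = +-cancelˡ-≡ᵇ m x y

<⇒≡ᵇ+-false : ∀ {a m} x → a < m → (a ≡ᵇ m + x) ≡ false
<⇒≡ᵇ+-false {a} {m} x a<m with a ≡ᵇ m + x | ≡ᵇ⇒≡ a (m + x)
... | false | _        = refl
... | true  | a≡m+x = ⊥-elim (<⇒≱ a<m (≤-trans (m≤m+n m x) (≤-reflexive (sym (a≡m+x _)))))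

<⇒<ᵇ≡true : ∀ {m n} → m < n → (m <ᵇ n) ≡ true
<⇒<ᵇ≡true {m} {n} m<n with m <ᵇ n | <⇒<ᵇ m<n
... | true | _ = refl

≮⇒<ᵇ≡false : ∀ {m n} → ¬ m < n → (m <ᵇ n) ≡ false
≮⇒<ᵇ≡false {m} {n} m≮n with m <ᵇ n | <ᵇ⇒< m n
... | false | _    = refl
... | true  | m<n = ⊥-elim (m≮n (m<n _))

head-++ : ∀ {A : Set} (u v : List A) {x} → head u ≡ just x → head (u ++ v) ≡ just x
head-++ (y ∷ u) v eq = eq

last-++ : ∀ {A : Set} (u v : List A) {x} → last v ≡ just x → last (u ++ v) ≡ just x
last-++ []           v           eq = eq
last-++ (y ∷ [])     (z ∷ v)     eq = eq
last-++ (y ∷ z ∷ u)  v           eq = last-++ (z ∷ u) v eq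

range-self : ∀ n → range n n ≡ []
range-self n = cong (map (n +_) ∘ upTo) (n∸n≡0 n)

range-suc : ∀ {lo m} → lo ≤ m → range lo (suc m) ≡ range lo m ∷ʳ m
range-suc {lo} {m} lo≤m = begin
  map (lo +_) (upTo (suc m ∸ lo))             ≡⟨ cong (map (lo +_) ∘ upTo) (+-∸-assoc 1 lo≤m) ⟩
  map (lo +_) (upTo (suc (m ∸ lo)))           ≡⟨ cong (map (lo +_)) (upTo-∷ʳ (m ∸ lo)) ⟨
  map (lo +_) (upTo (m ∸ lo) ∷ʳ (m ∸ lo))     ≡⟨ map-++ (lo +_) (upTo (m ∸ lo)) (m ∸ lo ∷ []) ⟩
  range lo m ∷ʳ (lo + (m ∸ lo))               ≡⟨ cong (range lo m ∷ʳ_) (m+[n∸m]≡n lo≤m) ⟩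
  range lo m ∷ʳ m                             ∎

sum-map-range-suc : ∀ (f : ℕ → ℕ) {lo m} → lo ≤ m →
  sum (map f (range lo (suc m))) ≡ sum (map f (range lo m)) + f m
sum-map-range-suc f {lo} {m} lo≤m = begin
  sum (map f (range lo (suc m)))          ≡⟨ cong (sum ∘ map f) (range-suc lo≤m) ⟩
  sum (map f (range lo m ∷ʳ m))           ≡⟨ cong sum (map-++ f (range lo m) (m ∷ [])) ⟩
  sum (map f (range lo m) ∷ʳ f m)         ≡⟨ sum-++ (map f (range lo m)) (f m ∷ []) ⟩
  sum (map f (range lo m)) + (f m + 0)    ≡⟨ cong (sum (map f (range lo m)) +_) (+-identityʳ (f m)) ⟩
  sum (map f (range lo m)) + f m          ∎

occ-∷ : ∀ B x xs → occ B (x ∷ xs) ≡ [ isPrefix B (x ∷ xs) ] + occ B xs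
occ-∷ B x xs with isPrefix B (x ∷ xs)
... | true  = refl
... | false = refl

occ-pair-[x] : ∀ a b x → occ (pair a b) (x ∷ []) ≡ 0
occ-pair-[x] a b x with a ≡ᵇ x
... | true  = refl
... | false = refl

junction : ℕ → ℕ → Maybe ℕ → Maybe ℕ → ℕ
junction a b (just x) (just y) = [ isPrefix (pair a b) (pair x y) ]
junction a b _        _        = 0

occ-pair-++ : ∀ a b u v →
  occ (pair a b) (u ++ v) ≡ occ (pair a b) u + occ (pair a b) v + junction a b (last u) (head v)
occ-pair-++ a b []          v       = sym (+-identityʳ (occ (pair a b) v))
occ-pair-++ a b (x ∷ [])    []      rewrite occ-pair-[x] a b x = refl
occ-pair-++ a b (x ∷ [])    (y ∷ v) rewrite occ-pair-[x] a b x =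
  trans (occ-∷ (pair a b) x (y ∷ v)) (+-comm _ (occ (pair a b) (y ∷ v)))
occ-pair-++ a b (x ∷ y ∷ u) v       = begin
  occ (pair a b) (x ∷ (y ∷ u) ++ v)    ≡⟨ occ-∷ (pair a b) x ((y ∷ u) ++ v) ⟩
  p + occ (pair a b) ((y ∷ u) ++ v)     ≡⟨ cong (p +_) (occ-pair-++ a b (y ∷ u) v) ⟩
  p + (q + r + j)                       ≡⟨ +-assoc p (q + r) j ⟨
  p + (q + r) + j                       ≡⟨ cong (_+ j) (+-assoc p q r) ⟨
  p + q + r + j                         ≡⟨ cong (λ t → t + r + j) (occ-∷ (pair a b) x (y ∷ u)) ⟨
  occ (pair a b) (x ∷ y ∷ u) + r + j    ∎
  where
  p q r j : ℕ
  p = [ isPrefix (pair a b) (pair x y) ]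
  q = occ (pair a b) (y ∷ u)
  r = occ (pair a b) v
  j = junction a b (last (y ∷ u)) (head v)

junction-second-≡ : ∀ a b x → junction a b (just x) (just b) ≡ [ a ≡ᵇ x ]
junction-second-≡ a b x rewrite ≡ᵇ-refl b = cong [_] (∧-identityʳ (a ≡ᵇ x))

junction-second-zero : ∀ a b x → junction a (suc b) (just x) (just 0) ≡ 0
junction-second-zero a b x = cong [_] (∧-zeroʳ (a ≡ᵇ x))

isPrefix-shift : ∀ m B s → isPrefix (map (m +_) B) (map (m +_) s) ≡ isPrefix B s
isPrefix-shift m []      s       = refl
isPrefix-shift m (_ ∷ _) []      = refl
isPrefix-shift m (x ∷ B) (y ∷ s) = cong₂ _∧_ (+-cancelˡ-≡ᵇ m x y) (isPrefix-shift m B s)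

occ-shift : ∀ m B w → occ (map (m +_) B) (map (m +_) w) ≡ occ B w
occ-shift m []      []      = refl
occ-shift m (_ ∷ _) []      = refl
occ-shift m B       (x ∷ w) = begin
  occ (map (m +_) B) (map (m +_) (x ∷ w))
    ≡⟨ occ-∷ (map (m +_) B) (m + x) (map (m +_) w) ⟩
  [ isPrefix (map (m +_) B) (map (m +_) (x ∷ w)) ] + occ (map (m +_) B) (map (m +_) w)
    ≡⟨ cong₂ _+_ (cong [_] (isPrefix-shift m B (x ∷ w))) (occ-shift m B w) ⟩
  [ isPrefix B (x ∷ w) ] + occ B w
    ≡⟨ occ-∷ B x w ⟨
  occ B (x ∷ w) ∎

occ-shift-below : ∀ {a m} B w → a < m → occ (a ∷ B) (map (m +_) w) ≡ 0
occ-shift-below B []      a<m = refl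
occ-shift-below {a} {m} B (x ∷ w) a<m
  rewrite occ-∷ (a ∷ B) (m + x) (map (m +_) w) | <⇒≡ᵇ+-false x a<m = occ-shift-below B w a<m

pair-shift : ∀ {m x} → m ≤ x → pair x m ≡ map (m +_) (pair (x ∸ m) 0)
pair-shift {m} m≤x = cong₂ pair (sym (m+[n∸m]≡n m≤x)) (sym (+-identityʳ m))

occ-pair-shift : ∀ m x w → occ (pair 0 0) w ≡ 0 →
  occ (pair x m) (map (m +_) w) ≡ [ m <ᵇ x ] * occ (pair (x ∸ m) 0) w
occ-pair-shift m x w no00 with <-cmp x m
... | tri< x<m _ _ rewrite ≮⇒<ᵇ≡false (<⇒≯ x<m) = occ-shift-below (m ∷ []) w x<m
... | tri≈ _ refl _ rewrite ≮⇒<ᵇ≡false (n≮n m) = begin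
  occ (pair m m) (map (m +_) w)                    ≡⟨ cong (λ B → occ B (map (m +_) w)) (pair-shift ≤-refl) ⟩
  occ (map (m +_) (pair (m ∸ m) 0)) (map (m +_) w) ≡⟨ occ-shift m (pair (m ∸ m) 0) w ⟩
  occ (pair (m ∸ m) 0) w                           ≡⟨ cong (λ y → occ (pair y 0) w) (n∸n≡0 m) ⟩
  occ (pair 0 0) w                                 ≡⟨ no00 ⟩
  0                                                ∎
... | tri> _ _ m<x rewrite <⇒<ᵇ≡true m<x = begin
  occ (pair x m) (map (m +_) w)                    ≡⟨ cong (λ B → occ B (map (m +_) w)) (pair-shift (<⇒≤ m<x)) ⟩
  occ (map (m +_) (pair (x ∸ m) 0)) (map (m +_) w) ≡⟨ occ-shift m (pair (x ∸ m) 0) w ⟩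
  occ (pair (x ∸ m) 0) w                           ≡⟨ +-identityʳ _ ⟨
  1 * occ (pair (x ∸ m) 0) w                       ∎

module Morphism (k-1 : ℕ) where

  k : ℕ
  k = suc k-1

  φ-++ : ∀ u v → φ k (u ++ v) ≡ φ k u ++ φ k v
  φ-++ = concatMap-++ (φ-letter k)

  φ^-++ : ∀ n u v → φ^ k n (u ++ v) ≡ φ^ k n u ++ φ^ k n v
  φ^-++ zero    u v = refl
  φ^-++ (suc n) u v = trans (cong (φ k) (φ^-++ n u v)) (φ-++ (φ^ k n u) (φ^ k n v))

  φ^-suc : ∀ n w → φ^ k (suc n) w ≡ φ^ k n (φ k w)
  φ^-suc zero    w = refl
  φ^-suc (suc n) w = cong (φ k) (φ^-suc n w)

  [k+m]%k≡m%k : ∀ m → (k + m) % k ≡ m % k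
  [k+m]%k≡m%k m = trans (cong (_% k) (+-comm k m)) ([m+n]%n≡m%n m k)

  [k+m]/k≡1+m/k : ∀ m → (k + m) / k ≡ suc (m / k)
  [k+m]/k≡1+m/k m = trans (m/n≡1+[m∸n]/n (m≤m+n k m)) (cong (λ t → suc (t / k)) (m+n∸m≡n k m))

  φ-letter-shift : ∀ m → φ-letter k (k + m) ≡ map (k +_) (φ-letter k m)
  φ-letter-shift m rewrite [k+m]%k≡m%k m | [k+m]/k≡1+m/k m with suc (m % k) <ᵇ k
  ... | true  = cong₂ (λ x y → x ∷ y ∷ []) (*-suc k (m / k)) (sym (+-suc k m))
  ... | false = cong (_∷ []) (sym (+-suc k m))

  φ-shift : ∀ w → φ k (map (k +_) w) ≡ map (k +_) (φ k w)
  φ-shift []      = refl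
  φ-shift (x ∷ w) = begin
    φ-letter k (k + x) ++ φ k (map (k +_) w)        ≡⟨ cong₂ _++_ (φ-letter-shift x) (φ-shift w) ⟩
    map (k +_) (φ-letter k x) ++ map (k +_) (φ k w) ≡⟨ map-++ (k +_) (φ-letter k x) (φ k w) ⟨
    map (k +_) (φ k (x ∷ w))                        ∎

  φ^-shift : ∀ n w → φ^ k n (map (k +_) w) ≡ map (k +_) (φ^ k n w)
  φ^-shift zero    w = refl
  φ^-shift (suc n) w = trans (cong (φ k) (φ^-shift n w)) (φ-shift (φ^ k n w))

  φ-letter-< : ∀ {j} → j < k-1 → φ-letter k j ≡ 0 ∷ suc j ∷ []
  φ-letter-< {j} j<k-1
    rewrite m<n⇒m%n≡m {n = k} (m<n⇒m<1+n j<k-1) | m<n⇒m/n≡0 {n = k} (m<n⇒m<1+n j<k-1)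
          | <⇒<ᵇ≡true j<k-1 = cong (_∷ suc j ∷ []) (*-zeroʳ k)

  φ-letter-top : φ-letter k k-1 ≡ k ∷ []
  φ-letter-top rewrite m<n⇒m%n≡m {n = k} (n<1+n k-1) | ≮⇒<ᵇ≡false (n≮n k-1) = refl

  Φ : ℕ → ℕ → List ℕ
  Φ n j = φ^ k n (j ∷ [])

  Φ-suc : ∀ n j → Φ (suc n) j ≡ φ^ k n (φ-letter k j)
  Φ-suc n j = trans (φ^-suc n (j ∷ [])) (cong (φ^ k n) (++-identityʳ (φ-letter k j)))

  Φ-suc-< : ∀ n {j} → j < k-1 → Φ (suc n) j ≡ Φ n 0 ++ Φ n (suc j)
  Φ-suc-< n {j} j<k-1 = begin
    Φ (suc n) j                       ≡⟨ Φ-suc n j ⟩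
    φ^ k n (φ-letter k j)             ≡⟨ cong (φ^ k n) (φ-letter-< j<k-1) ⟩
    φ^ k n ((0 ∷ []) ++ (suc j ∷ [])) ≡⟨ φ^-++ n (0 ∷ []) (suc j ∷ []) ⟩
    Φ n 0 ++ Φ n (suc j)              ∎

  Φ-suc-top : ∀ n → Φ (suc n) k-1 ≡ map (k +_) (Φ n 0)
  Φ-suc-top n = begin
    Φ (suc n) k-1                     ≡⟨ Φ-suc n k-1 ⟩
    φ^ k n (φ-letter k k-1)           ≡⟨ cong (φ^ k n) φ-letter-top ⟩
    φ^ k n (k ∷ [])                   ≡⟨ cong (λ x → φ^ k n (x ∷ [])) (+-identityʳ k) ⟨
    φ^ k n (map (k +_) (0 ∷ []))      ≡⟨ φ^-shift n (0 ∷ []) ⟩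
    map (k +_) (Φ n 0)                ∎

module Counting (k-2 : ℕ) where

  k-1 : ℕ
  k-1 = suc k-2

  open Morphism k-1

  head-Φ-suc-< : ∀ n {i} → i < k-1 → head (Φ (suc n) i) ≡ just 0
  head-Φ-0 : ∀ n → head (Φ n 0) ≡ just 0

  head-Φ-suc-< n i<k-1 = trans (cong head (Φ-suc-< n i<k-1)) (head-++ (Φ n 0) _ (head-Φ-0 n))

  head-Φ-0 zero    = refl
  head-Φ-0 (suc n) = head-Φ-suc-< n (s≤s z≤n)

  head-Φ-suc-top : ∀ n → head (Φ (suc n) k-1) ≡ just k
  head-Φ-suc-top n = begin
    head (Φ (suc n) k-1)                ≡⟨ cong head (Φ-suc-top n) ⟩
    head (map (k +_) (Φ n 0))           ≡⟨ head-map (Φ n 0) ⟩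
    Maybe.map (k +_) (head (Φ n 0))     ≡⟨ cong (Maybe.map (k +_)) (head-Φ-0 n) ⟩
    just (k + 0)                        ≡⟨ cong just (+-identityʳ k) ⟩
    just k                              ∎

  last-Φ : ∀ n {j} → j ≤ k-1 → last (Φ n j) ≡ just (j + n)
  last-Φ zero    {j} _ = cong just (sym (+-identityʳ j))
  last-Φ (suc n) {j} j≤k-1 with m≤n⇒m<n∨m≡n j≤k-1
  ... | inj₁ j<k-1 = begin
    last (Φ (suc n) j)                  ≡⟨ cong last (Φ-suc-< n j<k-1) ⟩
    last (Φ n 0 ++ Φ n (suc j))         ≡⟨ last-++ (Φ n 0) _ (last-Φ n j<k-1) ⟩
    just (suc j + n)                    ≡⟨ cong just (+-suc j n) ⟨
    just (j + suc n)                    ∎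
  ... | inj₂ refl = begin
    last (Φ (suc n) k-1)                ≡⟨ cong last (Φ-suc-top n) ⟩
    last (map (k +_) (Φ n 0))           ≡⟨ last-map (k +_) (Φ n 0) ⟩
    Maybe.map (k +_) (last (Φ n 0))     ≡⟨ cong (Maybe.map (k +_)) (last-Φ n z≤n) ⟩
    just (k + n)                        ≡⟨ cong just (+-suc k-1 n) ⟨
    just (k-1 + suc n)                  ∎

  occ-00-Φ : ∀ n {j} → j ≤ k-1 → occ (pair 0 0) (Φ n j) ≡ 0
  occ-00-Φ zero    {j} _ = occ-pair-[x] 0 0 j
  occ-00-Φ (suc n) {j} j≤k-1 with m≤n⇒m<n∨m≡n j≤k-1
  ... | inj₂ refl =
    trans (cong (occ (pair 0 0)) (Φ-suc-top n)) (occ-shift-below (0 ∷ []) (Φ n 0) (s≤s z≤n))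
  ... | inj₁ j<k-1 rewrite Φ-suc-< n j<k-1 | occ-pair-++ 0 0 (Φ n 0) (Φ n (suc j))
                         | occ-00-Φ n {0} z≤n | occ-00-Φ n j<k-1 | last-Φ n {0} z≤n = no-00-junction n
    where
    no-00-junction : ∀ n → junction 0 0 (just n) (head (Φ n (suc j))) ≡ 0
    no-00-junction zero    = refl
    no-00-junction (suc n) with head (Φ (suc n) (suc j))
    ... | just _  = refl
    ... | nothing = refl

  module _ (a-1 : ℕ) where

    a : ℕ
    a = suc a-1

    P P′ : List ℕ
    P  = pair a k
    P′ = pair (a ∸ k) 0

    -- Oriented as suc e + a ≡ᵇ n so that crossing (suc e) n ≡ crossing (suc (suc e)) (suc n)
    -- holds by refl.
    crossing : ℕ → ℕ → ℕ
    crossing zero    n = 0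
    crossing (suc e) n = [ suc e + a ≡ᵇ n ]

    junction-below-top : ∀ m {i} → i < k-1 → junction a k (last (Φ m 0)) (head (Φ m i)) ≡ 0
    junction-below-top zero    i<k-1 = refl
    junction-below-top (suc m) i<k-1 rewrite last-Φ (suc m) {0} z≤n | head-Φ-suc-< m i<k-1 =
      junction-second-zero a (suc k-2) (suc m)

    junction-top : ∀ m → junction a k (last (Φ m 0)) (head (Φ m k-1)) ≡ crossing 1 (suc m)
    junction-top zero    = refl
    junction-top (suc m) rewrite last-Φ (suc m) {0} z≤n | head-Φ-suc-top m =
      junction-second-≡ a k (suc m)

    crossing-suc : ∀ e m {j} → e + suc j ≡ k-1 →
      crossing e m + junction a k (last (Φ m 0)) (head (Φ m (suc j))) ≡ crossing (suc e) (suc m)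
    crossing-suc zero     m refl = junction-top m
    crossing-suc (suc e)  m {j} e+1+j+1≡k-1 =
      trans (cong (crossing (suc e) m +_) (junction-below-top m j+1<k-1)) (+-identityʳ _)
      where
      j+1<k-1 : suc j < k-1
      j+1<k-1 = subst (suc j <_) e+1+j+1≡k-1 (m<n+m (suc j) (s≤s z≤n))

    occ-Φ-zero : ∀ j → occ P (Φ 0 j) ≡ [ k <ᵇ a ] * 0 + 0
    occ-Φ-zero j = trans (occ-pair-[x] a k j) (sym (trans (+-identityʳ _) (*-zeroʳ [ k <ᵇ a ])))

    occ-Φ : ∀ e j n → e + j ≡ k-1 →
      occ P (Φ n j) ≡ sum (map (c k P) (range (n ∸ e) n)) + [ k <ᵇ a ] * cShift k P′ n (suc e) + crossing e n
    occ-Φ zero    j zero    _ = occ-Φ-zero j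
    occ-Φ (suc e) j zero    _ = occ-Φ-zero j
    occ-Φ zero    _ (suc m) refl = begin
      occ P (Φ (suc m) k-1)          ≡⟨ cong (occ P) (Φ-suc-top m) ⟩
      occ P (map (k +_) (Φ m 0))     ≡⟨ occ-pair-shift k a (Φ m 0) (occ-00-Φ m z≤n) ⟩
      X                              ≡⟨ +-identityʳ X ⟨
      X + 0                          ≡⟨ cong (λ xs → sum (map (c k P) xs) + X + 0) (range-self (suc m)) ⟨
      sum (map (c k P) (range (suc m) (suc m))) + X + 0 ∎
      where
      X : ℕ
      X = [ k <ᵇ a ] * c k P′ m
    occ-Φ (suc e) j (suc m) e+1+j≡k-1 = begin
      occ P (Φ (suc m) j)
        ≡⟨ cong (occ P) (Φ-suc-< m j<k-1) ⟩
      occ P (Φ m 0 ++ Φ m (suc j))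
        ≡⟨ occ-pair-++ a k (Φ m 0) (Φ m (suc j)) ⟩
      c k P m + occ P (Φ m (suc j)) + J
        ≡⟨ cong (λ t → c k P m + t + J) (occ-Φ e (suc j) m e+j+1≡k-1) ⟩
      c k P m + (S + X + crossing e m) + J
        ≡⟨ regroup (c k P m) S X (crossing e m) J ⟩
      (S + c k P m) + X + (crossing e m + J)
        ≡⟨ cong₂ (λ s t → s + X + t) (sym (sum-map-range-suc (c k P) (m∸n≤m m e)))
                                     (crossing-suc e m e+j+1≡k-1) ⟩
      sum (map (c k P) (range (m ∸ e) (suc m))) + X + crossing (suc e) (suc m) ∎
      where
      j<k-1 : j < k-1
      j<k-1 = subst (j <_) e+1+j≡k-1 (m<n+m j (s≤s z≤n))
      e+j+1≡k-1 : e + suc j ≡ k-1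
      e+j+1≡k-1 = trans (+-suc e j) e+1+j≡k-1
      S X J : ℕ
      S = sum (map (c k P) (range (m ∸ e) m))
      X = [ k <ᵇ a ] * cShift k P′ m (suc e)
      J = junction a k (last (Φ m 0)) (head (Φ m (suc j)))
      regroup : ∀ A S X I J → A + (S + X + I) + J ≡ (S + A) + X + (I + J)
      regroup = solve-∀

    crossing-top : ∀ n → crossing k-1 n ≡ [ n ≡ᵇ a + k ∸ 1 ]
    crossing-top n = begin
      [ k-1 + a ≡ᵇ n ]     ≡⟨ cong [_] (≡ᵇ-comm (k-1 + a) n) ⟩
      [ n ≡ᵇ k-1 + a ]     ≡⟨ cong (λ t → [ n ≡ᵇ t ]) (trans (+-comm k-1 a) (sym (+-∸-assoc a (s≤s z≤n)))) ⟩
      [ n ≡ᵇ a + k ∸ 1 ]   ∎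

    recurrence : ∀ n →
      c k P n ≡ sum (map (c k P) (range (n ∸ k-1) n)) + [ k <ᵇ a ] * cShift k P′ n k + [ n ≡ᵇ a + k ∸ 1 ]
    recurrence n rewrite sym (crossing-top n) = occ-Φ k-1 0 n (+-identityʳ k-1)

lemma5p10 : (k a : ℕ) → 2 ≤ k → 1 ≤ a → (n : ℕ) →
    c k (pair a k) n ≡
      sum (map (c k (pair a k)) (range (n ∸ (k ∸ 1)) n))
      + [ k <ᵇ a ] * cShift k (pair (a ∸ k) 0) n k
      + [ n ≡ᵇ a + k ∸ 1 ]
lemma5p10 (suc (suc k-2)) (suc a-1) (s≤s (s≤s z≤n)) (s≤s z≤n) = Counting.recurrence k-2 a-1
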